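{- For every finite graph $G$, the set of friendly separations of $G$ is nested.
   Context: A separation of a graph $G$ is a set $\{A,B\}$ with $A\cup B=V(G)$ such that $G$ has no edge between $A\setminus B$ and $B\setminus A$; its order is $|A\cap B|$; it is proper if $A\setminus B,B\setminus A\neq\emptyset$. Two separations $\{A,B\},\{C,D\}$ are nested if, after possibly renaming sides, $A\subseteq C$ and $B\supseteq D$; otherwise they cross. A set of separations is nested if its elements are pairwise nested. For crossing $\{A,B\},\{C,D\}$ the four corners are $\{A\cap C,B\cup D\}$, $\{A\cap D,B\cup C\}$, $\{B\cap D,A\cup C\}$, $\{B\cap C,A\cup D\}$; the first two lie on the same side of $\{A,B\}$, as do the last two. An entanglement in $G$ is a non-empty set $\varepsilon$ of proper separations such that: if $\{A,B\}\in\varepsilon$ is crossed by a separation of $G$ so that two corners lying on the same side of $\{A,B\}$ have order at most $|A\cap B|$, then at least one of them has order equal to $|A\cap B|$ and lies in $\varepsilon$. A separation $s$ is friendly if it lies in some entanglement $\varepsilon$ in $G$ such that no other separation in $\varepsilon$ crosses fewer separations than $s$, where only separations lying in (at least one) entanglement in $G$ are counted. -}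

module Defs where

open import Level using (0ℓ)
open import Data.Nat using (ℕ; _≤_)
open import Data.Fin using (Fin)
open import Data.Fin.Subset using (Subset; _∈_; _∉_; _⊆_; _∩_; _∪_; ∣_∣)
open import Data.Product using (Σ; _×_; _,_; ∃)
open import Data.Sum using (_⊎_)
open import Data.Empty using (⊥)
open import Data.List using (List; length)
open import Data.List.Membership.Propositional using () renaming (_∈_ to _∈ₗ_)
open import Data.List.Relation.Unary.AllPairs using (AllPairs)
open import Relation.Nullary using (¬_)
open import Relation.Binary.PropositionalEquality using (_≡_)

record Graph (n : ℕ) : Set₁ where
  field
    E     : Fin n → Fin n → Set
    sym   : ∀ {u v} → E u v → E v u
    irrefl : ∀ {u} → ¬ E u u
open Graph public

-- A separation {A,B} is represented by an ordered pair (A , B);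
-- (A , B) and (B , A) represent the same separation.
Sep : ℕ → Set
Sep n = Subset n × Subset n

module _ {n : ℕ} where

  IsSep : Graph n → Subset n → Subset n → Set
  IsSep G A B =
    (∀ v → v ∈ A ⊎ v ∈ B) ×
    (∀ u v → E G u v → u ∈ A → u ∉ B → v ∈ B → v ∉ A → ⊥)

  order : Subset n → Subset n → ℕ
  order A B = ∣ A ∩ B ∣

  Proper : Subset n → Subset n → Set
  Proper A B = (∃ λ v → v ∈ A × v ∉ B) × (∃ λ v → v ∈ B × v ∉ A)

  SameSep : Sep n → Sep n → Set
  SameSep (A , B) (C , D) = (A ≡ C × B ≡ D) ⊎ (A ≡ D × B ≡ C)

  Nested : Subset n → Subset n → Subset n → Subset n → Set
  Nested A B C D =
      (A ⊆ C × D ⊆ B)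
    ⊎ (A ⊆ D × C ⊆ B)
    ⊎ (B ⊆ C × D ⊆ A)
    ⊎ (B ⊆ D × C ⊆ A)

  Cross : Subset n → Subset n → Subset n → Subset n → Set
  Cross A B C D = ¬ Nested A B C D

  -- a set of separations, given by a predicate on representing ordered pairs
  SepSet : Set₁
  SepSet = Subset n → Subset n → Set

  _∈ₛ_ : Sep n → SepSet → Set
  (A , B) ∈ₛ ε = ε A B ⊎ ε B A

  SideCond : SepSet → ℕ → Subset n → Subset n → Subset n → Subset n → Set
  SideCond ε k X₁ Y₁ X₂ Y₂ =
    order X₁ Y₁ ≤ k → order X₂ Y₂ ≤ k →
      (order X₁ Y₁ ≡ k × (X₁ , Y₁) ∈ₛ ε) ⊎ (order X₂ Y₂ ≡ k × (X₂ , Y₂) ∈ₛ ε)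

  record Entanglement (G : Graph n) (ε : SepSet) : Set where
    field
      members-proper : ∀ A B → ε A B → IsSep G A B × Proper A B
      nonempty       : ∃ λ A → ∃ λ B → ε A B
      corners        : ∀ A B → (A , B) ∈ₛ ε → ∀ C D → IsSep G C D → Cross A B C D →
                         SideCond ε (order A B) (A ∩ C) (B ∪ D) (A ∩ D) (B ∪ C) ×
                         SideCond ε (order A B) (B ∩ D) (A ∪ C) (B ∩ C) (A ∪ D)

  InSomeEntanglement : Graph n → Subset n → Subset n → Set₁
  InSomeEntanglement G C D = Σ SepSet λ ε → Entanglement G ε × (C , D) ∈ₛ ε

  -- k is the number of (unordered) separations lying in some entanglement of G
  -- which cross {A,B}: witnessed by a duplicate-free (up to swapping sides)
  -- exhaustive list of them of length k.
  CrossCount : Graph n → Subset n → Subset n → ℕ → Set₁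
  CrossCount G A B k = Σ (List (Sep n)) λ L →
      length L ≡ k
    × AllPairs (λ x y → ¬ SameSep x y) L
    × (∀ {C D} → (C , D) ∈ₗ L → InSomeEntanglement G C D × Cross A B C D)
    × (∀ C D → InSomeEntanglement G C D → Cross A B C D →
         ∃ λ x → x ∈ₗ L × SameSep x (C , D))

  Friendly : Graph n → Subset n → Subset n → Set₁
  Friendly G A B = Σ SepSet λ ε → Entanglement G ε × (A , B) ∈ₛ ε ×
    Σ ℕ λ m → CrossCount G A B m ×
      (∀ C D → (C , D) ∈ₛ ε → ∀ k → CrossCount G C D k → m ≤ k)

-- Suppose friendly s = {A,B} and t = {C,D} cross, with |t| ≤ |s|.  Opposite corners have orders
-- summing to at most |s| + |t| (submodularity).  Every separation crossing a corner crosses s or t,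
-- one crossing two opposite corners crosses both, and t crosses s but neither of the corners
-- {A∩C, B∪D}, {B∩D, A∪C}; so the crossing numbers of two opposite corners sum to less than those of
-- s and t.  By the entanglement axiom, whenever both corners on one side of s have order at most |s|,
-- one of them has order exactly |s| and lies in the entanglement of s, so by friendliness its crossing
-- number is at least that of s; likewise for t.  A short case analysis on the corner orders shows that
-- these bounds are incompatible.
module Submission where

open import Defs hiding (sym)
open import Level using (0ℓ)
open import Data.Bool using (Bool; true; false; not)
open import Data.Bool.Properties using (not-involutive)
open import Data.Empty using (⊥; ⊥-elim)
open import Data.Fin.Subset using (Subset; inside; outside; _∩_; _∪_; _⊆_; ∣_∣)
open import Data.Fin.Subset.Properties
open import Data.List using (List; []; _∷_; _++_; length; filter)
open import Data.List.Properties using (length-++; length-filter; filter-notAll)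
open import Data.List.Membership.Propositional using (lose) renaming (_∈_ to _∈ₗ_)
open import Data.List.Membership.Propositional.Properties using (∈-++⁺ˡ; ∈-++⁺ʳ; ∈-++⁻; ∈-filter⁺; ∈-filter⁻)
import Data.List.Relation.Unary.All as All
open import Data.List.Relation.Unary.AllPairs using (AllPairs)
import Data.List.Relation.Unary.AllPairs.Properties as AllPairs
open import Data.Nat using (ℕ; suc; _+_; _≤_; _<_; _≤?_)
open import Data.Nat.Properties
open import Algebra.Properties.CommutativeSemigroup +-commutativeSemigroup using (interchange)
open import Data.Product using (_×_; _,_; ∃; ∃₂; proj₁; proj₂)
open import Data.Sum using (_⊎_; inj₁; inj₂; [_,_]′)
import Data.Sum as Sum
open import Data.Vec using ([]; _∷_)
open import Relation.Nullary using (¬_; Dec; yes; no)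
open import Relation.Nullary.Decidable using (¬?; _×-dec_; _⊎-dec_)
open import Relation.Unary using (Pred; Decidable)
open import Relation.Binary.PropositionalEquality using (_≡_; _≢_; refl; sym; trans; cong; cong₂; subst)

m+n≤o+p⇒o≤m⇒n≤p : ∀ {m n o p} → m + n ≤ o + p → o ≤ m → n ≤ p
m+n≤o+p⇒o≤m⇒n≤p {n = n} {o} {p} h o≤m = +-cancelˡ-≤ o n p (≤-trans (+-monoˡ-≤ n o≤m) h)

m+n≤o+p⇒o<m⇒n<p : ∀ {m n o p} → m + n ≤ o + p → o < m → n < p
m+n≤o+p⇒o<m⇒n<p {n = n} {o} {p} h o<m = +-cancelˡ-< o n p (≤-trans (+-monoˡ-≤ n o<m) h)

m+n≤o+p⇒p≤m⇒n≤o : ∀ {m n o p} → m + n ≤ o + p → p ≤ m → n ≤ o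
m+n≤o+p⇒p≤m⇒n≤o {m} {n} {o} {p} h = m+n≤o+p⇒o≤m⇒n≤p (subst (m + n ≤_) (+-comm o p) h)

m+n≤o+p⇒p<m⇒n<o : ∀ {m n o p} → m + n ≤ o + p → p < m → n < o
m+n≤o+p⇒p<m⇒n<o {m} {n} {o} {p} h = m+n≤o+p⇒o<m⇒n<p (subst (m + n ≤_) (+-comm o p) h)

+-comm-≤ˡ : ∀ m n {o} → m + n ≤ o → n + m ≤ o
+-comm-≤ˡ m n {o} = subst (_≤ o) (+-comm m n)

+-comm-<ˡ : ∀ m n {o} → m + n < o → n + m < o
+-comm-<ˡ m n {o} = subst (_< o) (+-comm m n)

m+n<o+p⇒¬[o≤m×p≤n] : ∀ {m n o p} → m + n < o + p → o ≤ m → p ≤ n → ⊥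
m+n<o+p⇒¬[o≤m×p≤n] h o≤m p≤n = <⇒≱ h (+-mono-≤ o≤m p≤n)

m+n<o+p⇒¬[p≤m×o≤n] : ∀ {m n o p} → m + n < o + p → p ≤ m → o ≤ n → ⊥
m+n<o+p⇒¬[p≤m×o≤n] {m} {n} {o} {p} h p≤m o≤n = m+n<o+p⇒¬[o≤m×p≤n] (subst (m + n <_) (+-comm o p) h) p≤m o≤n

-- If both x, y ≥ a then a < b, and if both x', y' ≥ b then b < a.
¬both-pairs-bounded : ∀ {a b x y x′ y′} → x + y < a + b → x′ + y′ < a + b →
                      a ≤ x → a ≤ y → b ≤ x′ → b ≤ y′ → ⊥
¬both-pairs-bounded {a} {b} h h′ a≤x a≤y b≤x′ b≤y′ =
  <-asym (+-cancelˡ-< a a b (≤-<-trans (+-mono-≤ a≤x a≤y) h))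
         (+-cancelʳ-< b b a (≤-<-trans (+-mono-≤ b≤x′ b≤y′) h′))

SideBound : (k m o₁ x₁ o₂ x₂ : ℕ) → Set
SideBound k m o₁ x₁ o₂ x₂ = o₁ ≤ k → o₂ ≤ k → (o₁ ≡ k × m ≤ x₁) ⊎ (o₂ ≡ k × m ≤ x₂)

SideBound-swap : ∀ {k m o₁ x₁ o₂ x₂} → SideBound k m o₁ x₁ o₂ x₂ → SideBound k m o₂ x₂ o₁ x₁
SideBound-swap h o₂≤k o₁≤k = Sum.swap (h o₁≤k o₂≤k)

-- The numbers attached to crossing friendly s = {A,B}, t = {C,D} of orders k, l and crossing numbers
-- ms, mt: ord i j and crossings i j belong to the corner {side A B i ∩ side C D j , side A B (not i) ∪
-- side C D (not j)}; s-side i j and t-side i j are the entanglement conditions for the two corners on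
-- side i of s resp. side j of t.
record CornerProfile (k l ms mt : ℕ) : Set where
  field
    ord crossings      : Bool → Bool → ℕ
    ord-opposite       : ∀ i j → ord i j + ord (not i) (not j) ≤ k + l
    crossings-opposite : ∀ i j → crossings i j + crossings (not i) (not j) < ms + mt
    s-side             : ∀ i j → SideBound k ms (ord i j) (crossings i j) (ord i (not j)) (crossings i (not j))
    t-side             : ∀ i j → SideBound l mt (ord i j) (crossings i j) (ord (not i) j) (crossings (not i) j)

module _ {k l ms mt : ℕ} (l≤k : l ≤ k) (P : CornerProfile k l ms mt) where
  open CornerProfile P

  private
    ord-opposite′ : ∀ i j → ord (not i) j + ord i (not j) ≤ k + l
    ord-opposite′ i j =
      subst (λ i′ → ord (not i) j + ord i′ (not j) ≤ k + l) (not-involutive i) (ord-opposite (not i) j)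

    crossings-opposite′ : ∀ i j → crossings (not i) j + crossings i (not j) < ms + mt
    crossings-opposite′ i j =
      subst (λ i′ → crossings (not i) j + crossings i′ (not j) < ms + mt) (not-involutive i)
            (crossings-opposite (not i) j)

    <l⇒≤k : ∀ {o} → o < l → o ≤ k
    <l⇒≤k o<l = ≤-trans (<⇒≤ o<l) l≤k

    <l⇒≢k : ∀ {o} → o < l → o ≢ k
    <l⇒≢k o<l = <⇒≢ (<-≤-trans o<l l≤k)

    ord≮l : ∀ i j → ord i j < l → ⊥
    ord≮l i j ord<l with ord (not i) j ≤? l
    ... | yes ord′≤l with t-side i j (<⇒≤ ord<l) ord′≤l
    ...   | inj₁ (ord≡l , _) = <-irrefl ord≡l ord<l
    ...   | inj₂ (ord′≡l , t-bound)
            with s-side i j (<l⇒≤k ord<l)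
                   (m+n≤o+p⇒p≤m⇒n≤o (ord-opposite′ i j) (≤-reflexive (sym ord′≡l)))
    ...     | inj₁ (ord≡k , _) = <l⇒≢k ord<l ord≡k
    ...     | inj₂ (_ , s-bound) = m+n<o+p⇒¬[p≤m×o≤n] (crossings-opposite′ i j) t-bound s-bound
    ord≮l i j ord<l | no ord′≰l
      with ord″<k ← m+n≤o+p⇒p<m⇒n<o (ord-opposite′ i j) (≰⇒> ord′≰l)
         | s-side i j (<l⇒≤k ord<l) (<⇒≤ ord″<k)
    ... | inj₁ (ord≡k , _) = <l⇒≢k ord<l ord≡k
    ... | inj₂ (ord″≡k , _) = <⇒≢ ord″<k ord″≡k

    ord≤k : ∀ i j → ord i j ≤ k
    ord≤k i j with ord i j ≤? k
    ... | yes ord≤k = ord≤k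
    ... | no ord≰k = ⊥-elim (ord≮l (not i) (not j) (m+n≤o+p⇒o<m⇒n<p (ord-opposite i j) (≰⇒> ord≰k)))

    ¬tight-s-bound : ∀ i j → ord i j ≡ k → ms ≤ crossings i j → ⊥
    ¬tight-s-bound i j ord≡k s-bound
      with opposite≤l ← m+n≤o+p⇒o≤m⇒n≤p (ord-opposite i j) (≤-reflexive (sym ord≡k))
      with s-side (not i) j (ord≤k (not i) j) (ord≤k (not i) (not j))
    ... | inj₁ (ord′≡k , s-bound′)
        with t-side i (not j) (m+n≤o+p⇒o≤m⇒n≤p (ord-opposite′ i j) (≤-reflexive (sym ord′≡k))) opposite≤l
    ...   | inj₁ (_ , t-bound) = m+n<o+p⇒¬[o≤m×p≤n] (crossings-opposite′ i j) s-bound′ t-bound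
    ...   | inj₂ (_ , t-bound) = m+n<o+p⇒¬[o≤m×p≤n] (crossings-opposite i j) s-bound t-bound
    ¬tight-s-bound i j ord≡k s-bound | inj₂ (opposite≡k , s-bound′)
      with k≤l ← subst (_≤ l) opposite≡k opposite≤l
      with t-side i j (≤-trans (ord≤k i j) k≤l) (≤-trans (ord≤k (not i) j) k≤l)
    ... | inj₁ (_ , t-bound) = m+n<o+p⇒¬[p≤m×o≤n] (crossings-opposite i j) t-bound s-bound′
    ... | inj₂ (_ , t-bound)
        with t-side i (not j) (≤-trans (ord≤k i (not j)) k≤l) opposite≤l
    ...   | inj₂ (_ , t-bound′) = m+n<o+p⇒¬[o≤m×p≤n] (crossings-opposite i j) s-bound t-bound′
    ...   | inj₁ (_ , t-bound′) =
            ¬both-pairs-bounded (crossings-opposite i j) (crossings-opposite′ i j) s-bound s-bound′ t-bound t-bound′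

  ¬CornerProfile : ⊥
  ¬CornerProfile with s-side true true (ord≤k true true) (ord≤k true false)
  ... | inj₁ (ord≡k , s-bound) = ¬tight-s-bound true true ord≡k s-bound
  ... | inj₂ (ord≡k , s-bound) = ¬tight-s-bound true false ord≡k s-bound

∣p∩q∣+∣p∪q∣≡∣p∣+∣q∣ : ∀ {n} (p q : Subset n) → ∣ p ∩ q ∣ + ∣ p ∪ q ∣ ≡ ∣ p ∣ + ∣ q ∣
∣p∩q∣+∣p∪q∣≡∣p∣+∣q∣ []            []            = refl
∣p∩q∣+∣p∪q∣≡∣p∣+∣q∣ (outside ∷ p) (outside ∷ q) = ∣p∩q∣+∣p∪q∣≡∣p∣+∣q∣ p q
∣p∩q∣+∣p∪q∣≡∣p∣+∣q∣ (outside ∷ p) (inside  ∷ q) =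
  trans (+-suc _ _) (trans (cong suc (∣p∩q∣+∣p∪q∣≡∣p∣+∣q∣ p q)) (sym (+-suc _ _)))
∣p∩q∣+∣p∪q∣≡∣p∣+∣q∣ (inside  ∷ p) (outside ∷ q) =
  trans (+-suc _ _) (cong suc (∣p∩q∣+∣p∪q∣≡∣p∣+∣q∣ p q))
∣p∩q∣+∣p∪q∣≡∣p∣+∣q∣ (inside  ∷ p) (inside  ∷ q) =
  cong suc (trans (+-suc _ _) (trans (cong suc (∣p∩q∣+∣p∪q∣≡∣p∣+∣q∣ p q)) (sym (+-suc _ _))))

module _ {a p q} {A : Set a} {P : Pred A p} {Q : Pred A q} (P? : Decidable P) (Q? : Decidable Q) where

  length-filter-disjoint : (∀ x → P x → Q x → ⊥) → ∀ xs →
    length (filter P? xs) + length (filter Q? xs) ≡ length (filter (λ x → P? x ⊎-dec Q? x) xs)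
  length-filter-disjoint disjoint [] = refl
  length-filter-disjoint disjoint (x ∷ xs) with P? x | Q? x
  ... | yes px | yes qx = ⊥-elim (disjoint x px qx)
  ... | yes _  | no _   = cong suc (length-filter-disjoint disjoint xs)
  ... | no _   | yes _  = trans (+-suc _ _) (cong suc (length-filter-disjoint disjoint xs))
  ... | no _   | no _   = length-filter-disjoint disjoint xs

module _ {n : ℕ} where

  private variable
    A B C D X Y : Subset n

  Nested-swapˡ : Nested A B C D → Nested B A C D
  Nested-swapˡ (inj₁ x)               = inj₂ (inj₂ (inj₁ x))
  Nested-swapˡ (inj₂ (inj₁ x))        = inj₂ (inj₂ (inj₂ x))
  Nested-swapˡ (inj₂ (inj₂ (inj₁ x))) = inj₁ x
  Nested-swapˡ (inj₂ (inj₂ (inj₂ x))) = inj₂ (inj₁ x)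

  Nested-swapʳ : Nested A B C D → Nested A B D C
  Nested-swapʳ (inj₁ x)               = inj₂ (inj₁ x)
  Nested-swapʳ (inj₂ (inj₁ x))        = inj₁ x
  Nested-swapʳ (inj₂ (inj₂ (inj₁ x))) = inj₂ (inj₂ (inj₂ x))
  Nested-swapʳ (inj₂ (inj₂ (inj₂ x))) = inj₂ (inj₂ (inj₁ x))

  Nested-sym : Nested A B C D → Nested C D A B
  Nested-sym (inj₁ (p , q))               = inj₂ (inj₂ (inj₂ (q , p)))
  Nested-sym (inj₂ (inj₁ (p , q)))        = inj₂ (inj₁ (q , p))
  Nested-sym (inj₂ (inj₂ (inj₁ (p , q)))) = inj₂ (inj₂ (inj₁ (q , p)))
  Nested-sym (inj₂ (inj₂ (inj₂ (p , q)))) = inj₁ (q , p)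

  Cross-swapˡ : Cross A B C D → Cross B A C D
  Cross-swapˡ cross nested = cross (Nested-swapˡ nested)

  Cross-swapʳ : Cross A B C D → Cross A B D C
  Cross-swapʳ cross nested = cross (Nested-swapʳ nested)

  Cross-sym : Cross A B C D → Cross C D A B
  Cross-sym cross nested = cross (Nested-sym nested)

  nested? : (A B C D : Subset n) → Dec (Nested A B C D)
  nested? A B C D = ((A ⊆? C) ×-dec (D ⊆? B)) ⊎-dec ((A ⊆? D) ×-dec (C ⊆? B))
             ⊎-dec ((B ⊆? C) ×-dec (D ⊆? A)) ⊎-dec ((B ⊆? D) ×-dec (C ⊆? A))

  private
    ∩-lowerˡ : ∀ {A B X : Subset n} → A ⊆ X → A ∩ B ⊆ X
    ∩-lowerˡ {A} {B} A⊆X = ⊆-trans (p∩q⊆p A B) A⊆X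

    ∩-lowerʳ : ∀ {A B X : Subset n} → B ⊆ X → A ∩ B ⊆ X
    ∩-lowerʳ {A} {B} B⊆X = ⊆-trans (p∩q⊆q A B) B⊆X

    ∪-upperˡ : ∀ {A B X : Subset n} → X ⊆ A → X ⊆ A ∪ B
    ∪-upperˡ {B = B} X⊆A = ⊆-trans X⊆A (p⊆p∪q B)

    ∪-upperʳ : ∀ {A B X : Subset n} → X ⊆ B → X ⊆ A ∪ B
    ∪-upperʳ {A} {B} X⊆B = ⊆-trans X⊆B (q⊆p∪q A B)

    ∩-glb : ∀ {A B X : Subset n} → X ⊆ A → X ⊆ B → X ⊆ A ∩ B
    ∩-glb X⊆A X⊆B x∈X = x∈p∩q⁺ (X⊆A x∈X , X⊆B x∈X)

    ∪-lub : ∀ {A B X : Subset n} → A ⊆ X → B ⊆ X → A ∪ B ⊆ X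
    ∪-lub {A} {B} A⊆X B⊆X x∈A∪B = [ A⊆X , B⊆X ]′ (x∈p∪q⁻ A B x∈A∪B)

  Nested-corner : Cross A B C D → Nested A B X Y → Nested C D X Y → Nested (A ∩ C) (B ∪ D) X Y
  Nested-corner _ (inj₁ (p , q))        _ = inj₁ (∩-lowerˡ p , ∪-upperˡ q)
  Nested-corner _ (inj₂ (inj₁ (p , q))) _ = inj₂ (inj₁ (∩-lowerˡ p , ∪-upperˡ q))
  Nested-corner _ _ (inj₁ (p , q))        = inj₁ (∩-lowerʳ p , ∪-upperʳ q)
  Nested-corner _ _ (inj₂ (inj₁ (p , q))) = inj₂ (inj₁ (∩-lowerʳ p , ∪-upperʳ q))
  Nested-corner _ (inj₂ (inj₂ (inj₁ (p , q)))) (inj₂ (inj₂ (inj₁ (p′ , q′)))) =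
    inj₂ (inj₂ (inj₁ (∪-lub p p′ , ∩-glb q q′)))
  Nested-corner _ (inj₂ (inj₂ (inj₂ (p , q)))) (inj₂ (inj₂ (inj₂ (p′ , q′)))) =
    inj₂ (inj₂ (inj₂ (∪-lub p p′ , ∩-glb q q′)))
  Nested-corner cross (inj₂ (inj₂ (inj₁ (p , q)))) (inj₂ (inj₂ (inj₂ (p′ , q′)))) =
    ⊥-elim (cross (inj₂ (inj₂ (inj₁ (⊆-trans p q′ , ⊆-trans p′ q)))))
  Nested-corner cross (inj₂ (inj₂ (inj₂ (p , q)))) (inj₂ (inj₂ (inj₁ (p′ , q′)))) =
    ⊥-elim (cross (inj₂ (inj₂ (inj₁ (⊆-trans p q′ , ⊆-trans p′ q)))))

  Nestedˡ-corners : Nested A B X Y → Nested (A ∩ C) (B ∪ D) X Y ⊎ Nested (B ∩ D) (A ∪ C) X Y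
  Nestedˡ-corners (inj₁ (p , q))               = inj₁ (inj₁ (∩-lowerˡ p , ∪-upperˡ q))
  Nestedˡ-corners (inj₂ (inj₁ (p , q)))        = inj₁ (inj₂ (inj₁ (∩-lowerˡ p , ∪-upperˡ q)))
  Nestedˡ-corners (inj₂ (inj₂ (inj₁ (p , q)))) = inj₂ (inj₁ (∩-lowerˡ p , ∪-upperˡ q))
  Nestedˡ-corners (inj₂ (inj₂ (inj₂ (p , q)))) = inj₂ (inj₂ (inj₁ (∩-lowerˡ p , ∪-upperˡ q)))

  Nestedʳ-corners : Nested C D X Y → Nested (A ∩ C) (B ∪ D) X Y ⊎ Nested (B ∩ D) (A ∪ C) X Y
  Nestedʳ-corners (inj₁ (p , q))               = inj₁ (inj₁ (∩-lowerʳ p , ∪-upperʳ q))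
  Nestedʳ-corners (inj₂ (inj₁ (p , q)))        = inj₁ (inj₂ (inj₁ (∩-lowerʳ p , ∪-upperʳ q)))
  Nestedʳ-corners (inj₂ (inj₂ (inj₁ (p , q)))) = inj₂ (inj₁ (∩-lowerʳ p , ∪-upperʳ q))
  Nestedʳ-corners (inj₂ (inj₂ (inj₂ (p , q)))) = inj₂ (inj₂ (inj₁ (∩-lowerʳ p , ∪-upperʳ q)))

  corner-Nestedʳ : Nested (A ∩ C) (B ∪ D) C D
  corner-Nestedʳ = inj₁ (∩-lowerʳ ⊆-refl , ∪-upperʳ ⊆-refl)

  opposite-corner-Nestedʳ : Nested (B ∩ D) (A ∪ C) C D
  opposite-corner-Nestedʳ = inj₂ (inj₁ (∩-lowerʳ ⊆-refl , ∪-upperʳ ⊆-refl))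

  order-corners-submodular : (A B C D : Subset n) →
    order (A ∩ C) (B ∪ D) + order (B ∩ D) (A ∪ C) ≤ order A B + order C D
  order-corners-submodular A B C D = begin
    ∣ r ∣ + ∣ r′ ∣                        ≡⟨ sym (∣p∩q∣+∣p∪q∣≡∣p∣+∣q∣ r r′) ⟩
    ∣ r ∩ r′ ∣ + ∣ r ∪ r′ ∣               ≤⟨ +-mono-≤ (p⊆q⇒∣p∣≤∣q∣ r∩r′⊆) (p⊆q⇒∣p∣≤∣q∣ r∪r′⊆) ⟩
    ∣ A∩B ∩ C∩D ∣ + ∣ A∩B ∪ C∩D ∣         ≡⟨ ∣p∩q∣+∣p∪q∣≡∣p∣+∣q∣ A∩B C∩D ⟩
    ∣ A∩B ∣ + ∣ C∩D ∣                     ∎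
    where
    open ≤-Reasoning
    r r′ A∩B C∩D : Subset n
    r = (A ∩ C) ∩ (B ∪ D)
    r′ = (B ∩ D) ∩ (A ∪ C)
    A∩B = A ∩ B
    C∩D = C ∩ D

    r∩r′⊆ : r ∩ r′ ⊆ A∩B ∩ C∩D
    r∩r′⊆ x∈ with x∈r , x∈r′ ← x∈p∩q⁻ r r′ x∈
                with x∈A , x∈C ← x∈p∩q⁻ A C (p∩q⊆p _ _ x∈r)
                   | x∈B , x∈D ← x∈p∩q⁻ B D (p∩q⊆p _ _ x∈r′)
      = x∈p∩q⁺ (x∈p∩q⁺ (x∈A , x∈B) , x∈p∩q⁺ (x∈C , x∈D))

    r∪r′⊆ : r ∪ r′ ⊆ A∩B ∪ C∩D
    r∪r′⊆ x∈ with x∈p∪q⁻ r r′ x∈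
    ... | inj₁ x∈r with x∈A , x∈C ← x∈p∩q⁻ A C (p∩q⊆p _ _ x∈r)
      = [ (λ x∈B → x∈p∪q⁺ (inj₁ (x∈p∩q⁺ (x∈A , x∈B))))
        , (λ x∈D → x∈p∪q⁺ (inj₂ (x∈p∩q⁺ (x∈C , x∈D)))) ]′ (x∈p∪q⁻ B D (p∩q⊆q _ _ x∈r))
    ... | inj₂ x∈r′ with x∈B , x∈D ← x∈p∩q⁻ B D (p∩q⊆p _ _ x∈r′)
      = [ (λ x∈A → x∈p∪q⁺ (inj₁ (x∈p∩q⁺ (x∈A , x∈B))))
        , (λ x∈C → x∈p∪q⁺ (inj₂ (x∈p∩q⁺ (x∈C , x∈D)))) ]′ (x∈p∪q⁻ A C (p∩q⊆q _ _ x∈r′))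

  side : Subset n → Subset n → Bool → Subset n
  side X Y true  = X
  side X Y false = Y

  cornerOrder : (A B C D : Subset n) → Bool → Bool → ℕ
  cornerOrder A B C D i j = order (side A B i ∩ side C D j) (side A B (not i) ∪ side C D (not j))

  cornerOrder-opposite : ∀ A B C D i j →
    cornerOrder A B C D i j + cornerOrder A B C D (not i) (not j) ≤ order A B + order C D
  cornerOrder-opposite A B C D true  true  = order-corners-submodular A B C D
  cornerOrder-opposite A B C D true  false =
    subst (λ Z → order (A ∩ D) (B ∪ C) + order (B ∩ C) (A ∪ D) ≤ order A B + ∣ Z ∣)
          (∩-comm D C) (order-corners-submodular A B D C)
  cornerOrder-opposite A B C D false true  =
    +-comm-≤ˡ (cornerOrder A B C D true false) _ (cornerOrder-opposite A B C D true false)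
  cornerOrder-opposite A B C D false false =
    +-comm-≤ˡ (cornerOrder A B C D true true) _ (cornerOrder-opposite A B C D true true)

  Crosses : Sep n → Pred (Sep n) 0ℓ
  Crosses (A , B) (C , D) = Cross A B C D

  crosses? : ∀ s → Decidable (Crosses s)
  crosses? (A , B) (C , D) = ¬? (nested? A B C D)

  SameSep-sym : ∀ {x y : Sep n} → SameSep x y → SameSep y x
  SameSep-sym (inj₁ (refl , refl)) = inj₁ (refl , refl)
  SameSep-sym (inj₂ (refl , refl)) = inj₂ (refl , refl)

  Crosses-resp-SameSep : ∀ s {x y} → SameSep x y → Crosses s x → Crosses s y
  Crosses-resp-SameSep _ (inj₁ (refl , refl)) cross = cross
  Crosses-resp-SameSep _ (inj₂ (refl , refl)) cross = Cross-swapʳ cross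

  Crosses-corner : ∀ {A B C D : Subset n} {x} → Cross A B C D →
    Crosses (A ∩ C , B ∪ D) x → Crosses (A , B) x ⊎ Crosses (C , D) x
  Crosses-corner {A} {B} {C} {D} {X , Y} cross crosses-corner with nested? A B X Y | nested? C D X Y
  ... | yes nested | yes nested′ = ⊥-elim (crosses-corner (Nested-corner cross nested nested′))
  ... | no crosses | _           = inj₁ crosses
  ... | yes _      | no crosses  = inj₂ crosses

  crosses-but-not? : ∀ r t → Decidable (λ x → Crosses r x × ¬ Crosses t x)
  crosses-but-not? r t x = crosses? r x ×-dec ¬? (crosses? t x)

module _ {n : ℕ} (G : Graph n) where

  -- CrossCount G A B k unfolds to Σ L (length L ≡ k × CrossList (A , B) L).
  CrossList : Sep n → List (Sep n) → Set₁
  CrossList s L =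
      AllPairs (λ x y → ¬ SameSep x y) L
    × (∀ {C D} → (C , D) ∈ₗ L → InSomeEntanglement G C D × Crosses s (C , D))
    × (∀ C D → InSomeEntanglement G C D → Crosses s (C , D) → ∃ λ x → x ∈ₗ L × SameSep x (C , D))

  CrossCount-swap : ∀ {A B k} → CrossCount G A B k → CrossCount G B A k
  CrossCount-swap (L , len , distinct , sound , complete) =
    L , len , distinct , (λ x∈L → proj₁ (sound x∈L) , Cross-swapˡ (proj₂ (sound x∈L))) ,
    (λ C D ent cross → complete C D ent (Cross-swapˡ cross))

  -- If every separation crossing r crosses s or t, those crossing r are listed, each once, by the
  -- members of Ls that cross r but not t together with the members of Lt that cross r.
  coveredList : Sep n → Sep n → List (Sep n) → List (Sep n) → List (Sep n)
  coveredList r t Ls Lt = filter (crosses-but-not? r t) Ls ++ filter (crosses? r) Lt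

  CrossList-covered : ∀ {r s t Ls Lt} → CrossList s Ls → CrossList t Lt →
    (∀ x → Crosses r x → Crosses s x ⊎ Crosses t x) → CrossList r (coveredList r t Ls Lt)
  CrossList-covered {r} {s} {t} {Ls} {Lt}
    (distinctₛ , soundₛ , completeₛ) (distinctₜ , soundₜ , completeₜ) covered = distinct , sound , complete
    where
    fromₛ : ∀ {x} → x ∈ₗ filter (crosses-but-not? r t) Ls → x ∈ₗ Ls × Crosses r x × ¬ Crosses t x
    fromₛ = ∈-filter⁻ (crosses-but-not? r t) {xs = Ls}

    fromₜ : ∀ {x} → x ∈ₗ filter (crosses? r) Lt → x ∈ₗ Lt × Crosses r x
    fromₜ = ∈-filter⁻ (crosses? r) {xs = Lt}

    distinct : AllPairs (λ x y → ¬ SameSep x y) (coveredList r t Ls Lt)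
    distinct =
      AllPairs.++⁺ (AllPairs.filter⁺ (crosses-but-not? r t) distinctₛ) (AllPairs.filter⁺ (crosses? r) distinctₜ)
      (All.tabulate λ x∈ → All.tabulate λ y∈ same →
        proj₂ (proj₂ (fromₛ x∈))
          (Crosses-resp-SameSep t (SameSep-sym same) (proj₂ (soundₜ (proj₁ (fromₜ y∈))))))

    sound : ∀ {C D} → (C , D) ∈ₗ coveredList r t Ls Lt → InSomeEntanglement G C D × Crosses r (C , D)
    sound x∈ with ∈-++⁻ (filter (crosses-but-not? r t) Ls) x∈
    ... | inj₁ x∈ₛ = proj₁ (soundₛ (proj₁ (fromₛ x∈ₛ))) , proj₁ (proj₂ (fromₛ x∈ₛ))
    ... | inj₂ x∈ₜ = proj₁ (soundₜ (proj₁ (fromₜ x∈ₜ))) , proj₂ (fromₜ x∈ₜ)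

    complete : ∀ C D → InSomeEntanglement G C D → Crosses r (C , D) →
               ∃ λ x → x ∈ₗ coveredList r t Ls Lt × SameSep x (C , D)
    complete C D ent cross with crosses? t (C , D)
    ... | yes crossesₜ with x , x∈ , same ← completeₜ C D ent crossesₜ =
      x , ∈-++⁺ʳ (filter (crosses-but-not? r t) Ls)
            (∈-filter⁺ (crosses? r) x∈ (Crosses-resp-SameSep r (SameSep-sym same) cross)) , same
    ... | no ¬crossesₜ with crossesₛ ← [ (λ c → c) , (λ c → ⊥-elim (¬crossesₜ c)) ]′ (covered _ cross)
                       with x , x∈ , same ← completeₛ C D ent crossesₛ =
      x , ∈-++⁺ˡ (∈-filter⁺ (crosses-but-not? r t) x∈
                   (Crosses-resp-SameSep r (SameSep-sym same) cross ,
                    λ crossesₜ → ¬crossesₜ (Crosses-resp-SameSep t same crossesₜ))) , same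

  crossCount-opposite-corners : ∀ {A B C D ms mt} → CrossCount G A B ms → CrossCount G C D mt →
    InSomeEntanglement G C D → Cross A B C D →
    ∃₂ λ x y → CrossCount G (A ∩ C) (B ∪ D) x × CrossCount G (B ∩ D) (A ∪ C) y × x + y < ms + mt
  crossCount-opposite-corners {A} {B} {C} {D} (Ls , refl , listₛ) (Lt , refl , listₜ) ent cross =
    _ , _ , (Lr , refl , CrossList-covered listₛ listₜ coveredᵣ) ,
            (Lr′ , refl , CrossList-covered listₜ listₛ coveredᵣ′) , shorter
    where
    s t r r′ : Sep n
    s = A , B
    t = C , D
    r = A ∩ C , B ∪ D
    r′ = B ∩ D , A ∪ C

    Lr Lr′ : List (Sep n)
    Lr = coveredList r t Ls Lt
    Lr′ = coveredList r′ s Lt Ls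

    coveredᵣ : ∀ x → Crosses r x → Crosses s x ⊎ Crosses t x
    coveredᵣ x = Crosses-corner cross

    coveredᵣ′ : ∀ x → Crosses r′ x → Crosses t x ⊎ Crosses s x
    coveredᵣ′ x crosses =
      Sum.swap (Sum.map Cross-swapˡ Cross-swapˡ (Crosses-corner (Cross-swapˡ (Cross-swapʳ cross)) crosses))

    disjointₛ : ∀ x → Crosses r x × ¬ Crosses t x → Crosses r′ x → ⊥
    disjointₛ x (crossesᵣ , ¬crossesₜ) crossesᵣ′ =
      ¬crossesₜ λ nested → [ crossesᵣ , crossesᵣ′ ]′ (Nestedʳ-corners nested)

    disjointₜ : ∀ x → Crosses r x → Crosses r′ x × ¬ Crosses s x → ⊥
    disjointₜ x crossesᵣ (crossesᵣ′ , ¬crossesₛ) =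
      ¬crossesₛ λ nested → [ crossesᵣ , crossesᵣ′ ]′ (Nestedˡ-corners nested)

    t-crosses-neither : ∀ {x} → SameSep x t → ¬ ((Crosses r x × ¬ Crosses t x) ⊎ Crosses r′ x)
    t-crosses-neither same (inj₁ (crossesᵣ , _)) = Crosses-resp-SameSep r same crossesᵣ corner-Nestedʳ
    t-crosses-neither same (inj₂ crossesᵣ′) = Crosses-resp-SameSep r′ same crossesᵣ′ opposite-corner-Nestedʳ

    a b c d : ℕ
    a = length (filter (crosses-but-not? r t) Ls)
    b = length (filter (crosses? r) Lt)
    c = length (filter (crosses-but-not? r′ s) Lt)
    d = length (filter (crosses? r′) Ls)

    a+d<∣Ls∣ : a + d < length Ls
    a+d<∣Ls∣ with x , x∈Ls , same ← proj₂ (proj₂ listₛ) C D ent cross = begin-strict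
      a + d   ≡⟨ length-filter-disjoint (crosses-but-not? r t) (crosses? r′) disjointₛ Ls ⟩
      length (filter _ Ls)  <⟨ filter-notAll _ Ls (lose x∈Ls (t-crosses-neither same)) ⟩
      length Ls             ∎
      where open ≤-Reasoning

    b+c≤∣Lt∣ : b + c ≤ length Lt
    b+c≤∣Lt∣ = begin
      b + c   ≡⟨ length-filter-disjoint (crosses? r) (crosses-but-not? r′ s) disjointₜ Lt ⟩
      length (filter _ Lt)  ≤⟨ length-filter _ Lt ⟩
      length Lt             ∎
      where open ≤-Reasoning

    shorter : length Lr + length Lr′ < length Ls + length Lt
    shorter = begin-strict
      length Lr + length Lr′  ≡⟨ cong₂ _+_ (length-++ (filter (crosses-but-not? r t) Ls))
                                           (length-++ (filter (crosses-but-not? r′ s) Lt)) ⟩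
      (a + b) + (c + d)       ≡⟨ trans (cong (a + b +_) (+-comm c d)) (interchange a b d c) ⟩
      (a + d) + (b + c)       <⟨ +-mono-<-≤ a+d<∣Ls∣ b+c≤∣Lt∣ ⟩
      length Ls + length Lt   ∎
      where open ≤-Reasoning

module _ {n : ℕ} (G : Graph n) where

  IsSep-swap : ∀ {A B} → IsSep G A B → IsSep G B A
  IsSep-swap (covers , no-edge) =
    (λ v → Sum.swap (covers v)) ,
    (λ u v uv u∈B u∉A v∈A v∉B → no-edge v u (Graph.sym G uv) v∈A v∉B u∈B u∉A)

  member-IsSep : ∀ {ε A B} → Entanglement G ε → (A , B) ∈ₛ ε → IsSep G A B
  member-IsSep ent (inj₁ AB∈ε) = proj₁ (Entanglement.members-proper ent _ _ AB∈ε)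
  member-IsSep ent (inj₂ BA∈ε) = IsSep-swap (proj₁ (Entanglement.members-proper ent _ _ BA∈ε))

  SideCond-cong : ∀ {ε k} {X Y Z W X′ Y′ Z′ W′ : Subset n} → X ≡ X′ → Y ≡ Y′ → Z ≡ Z′ → W ≡ W′ →
                  SideCond ε k X Y Z W → SideCond ε k X′ Y′ Z′ W′
  SideCond-cong refl refl refl refl cond = cond

  SideCond⇒SideBound : ∀ {ε m k x₁ x₂} {X Y Z W : Subset n} →
    (∀ C D → (C , D) ∈ₛ ε → ∀ k → CrossCount G C D k → m ≤ k) →
    CrossCount G X Y x₁ → CrossCount G Z W x₂ →
    SideCond ε k X Y Z W → SideBound k m (order X Y) x₁ (order Z W) x₂
  SideCond⇒SideBound {X = X} {Y} {Z} {W} minimal count₁ count₂ cond o₁≤k o₂≤k with cond o₁≤k o₂≤k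
  ... | inj₁ (o₁≡k , XY∈ε) = inj₁ (o₁≡k , minimal X Y XY∈ε _ count₁)
  ... | inj₂ (o₂≡k , ZW∈ε) = inj₂ (o₂≡k , minimal Z W ZW∈ε _ count₂)

  friendly-crossing-profile : ∀ {A B C D} → Friendly G A B → Friendly G C D → Cross A B C D →
    ∃₂ λ ms mt → CornerProfile (order A B) (order C D) ms mt
  friendly-crossing-profile {A} {B} {C} {D}
    (ε , ent , s∈ε , ms , countₛ , minimalₛ) (ε′ , ent′ , t∈ε′ , mt , countₜ , minimalₜ) cross
    with crossCount-opposite-corners G countₛ countₜ (ε′ , ent′ , t∈ε′) cross
       | crossCount-opposite-corners G countₛ (CrossCount-swap G countₜ) (ε′ , ent′ , Sum.swap t∈ε′)
                                     (Cross-swapʳ cross)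
  ... | xAC , xBD , countAC , countBD , diagonal | xAD , xBC , countAD , countBC , antidiagonal =
    ms , mt , record
      { ord = ord ; crossings = crossings ; ord-opposite = cornerOrder-opposite A B C D
      ; crossings-opposite = crossings-opposite ; s-side = s-side ; t-side = t-side }
    where
    k l : ℕ
    k = order A B
    l = order C D

    ord : Bool → Bool → ℕ
    ord = cornerOrder A B C D

    crossings : Bool → Bool → ℕ
    crossings true  true  = xAC
    crossings true  false = xAD
    crossings false true  = xBC
    crossings false false = xBD

    crossings-opposite : ∀ i j → crossings i j + crossings (not i) (not j) < ms + mt
    crossings-opposite true  true  = diagonal
    crossings-opposite true  false = antidiagonal
    crossings-opposite false true  = +-comm-<ˡ xAD xBC antidiagonal
    crossings-opposite false false = +-comm-<ˡ xAC xBD diagonal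

    cornersₛ : SideCond ε k (A ∩ C) (B ∪ D) (A ∩ D) (B ∪ C) × SideCond ε k (B ∩ D) (A ∪ C) (B ∩ C) (A ∪ D)
    cornersₛ = Entanglement.corners ent A B s∈ε C D (member-IsSep ent′ t∈ε′) cross

    cornersₜ : SideCond ε′ l (C ∩ A) (D ∪ B) (C ∩ B) (D ∪ A) × SideCond ε′ l (D ∩ B) (C ∪ A) (D ∩ A) (C ∪ B)
    cornersₜ = Entanglement.corners ent′ C D t∈ε′ A B (member-IsSep ent s∈ε) (Cross-sym cross)

    boundA : SideBound k ms (ord true true) xAC (ord true false) xAD
    boundA = SideCond⇒SideBound minimalₛ countAC countAD (proj₁ cornersₛ)

    boundB : SideBound k ms (ord false false) xBD (ord false true) xBC
    boundB = SideCond⇒SideBound minimalₛ countBD countBC (proj₂ cornersₛ)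

    boundC : SideBound l mt (ord true true) xAC (ord false true) xBC
    boundC = SideCond⇒SideBound minimalₜ countAC countBC
               (SideCond-cong {ε′} (∩-comm C A) (∪-comm D B) (∩-comm C B) (∪-comm D A) (proj₁ cornersₜ))

    boundD : SideBound l mt (ord false false) xBD (ord true false) xAD
    boundD = SideCond⇒SideBound minimalₜ countBD countAD
               (SideCond-cong {ε′} (∩-comm D B) (∪-comm C A) (∩-comm D A) (∪-comm C B) (proj₂ cornersₜ))

    s-side : ∀ i j → SideBound k ms (ord i j) (crossings i j) (ord i (not j)) (crossings i (not j))
    s-side true  true  = boundA
    s-side true  false = SideBound-swap boundA
    s-side false true  = SideBound-swap boundB
    s-side false false = boundB

    t-side : ∀ i j → SideBound l mt (ord i j) (crossings i j) (ord (not i) j) (crossings (not i) j)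
    t-side true  true  = boundC
    t-side true  false = SideBound-swap boundD
    t-side false true  = SideBound-swap boundC
    t-side false false = boundD

theorem3p5 : (n : ℕ) (G : Graph n) (A B C D : Subset n) →
    Friendly G A B → Friendly G C D → Nested A B C D
theorem3p5 n G A B C D friendlyₛ friendlyₜ with nested? A B C D
... | yes nested = nested
... | no cross with ≤-total (order C D) (order A B)
...   | inj₁ l≤k with _ , _ , profile ← friendly-crossing-profile G friendlyₛ friendlyₜ cross =
        ⊥-elim (¬CornerProfile l≤k profile)
...   | inj₂ k≤l with _ , _ , profile ← friendly-crossing-profile G friendlyₜ friendlyₛ (Cross-sym cross) =
        ⊥-elim (¬CornerProfile k≤l profile)
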